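{- Let $s,t$ be indeterminates and define the generalized Lucas numbers $\{n\}\in\mathbb{Z}[s,t]$ by $\{0\}=0$, $\{1\}=1$ and $\{n\}=s\{n-1\}+t\{n-2\}$ for $n\ge 2$. Define the Lucas-Eulerian numbers $E_{\{n,k\}}$ (for integers $n\ge0$ and $k$) by the initial conditions $E_{\{n,0\}}=E_{\{n,n\}}=1$ for $n\ge0$, $E_{\{n,k\}}=0$ if $n<k$ or $k<0$, and the recursion $$E_{\{n,k\}}=\{k+1\}E_{\{n-1,k\}}+\{n-k+1\}E_{\{n-1,k-1\}}\quad\text{for }0\le k\le n.$$ Then the Lucas-Eulerian numbers are palindromic: $E_{\{n,k\}}=E_{\{n,n-k\}}$ for all integers $0\le k\le n$.
   Context: $s$ and $t$ are independent indeterminates; the $E_{\{n,k\}}$ are polynomials in $s,t$ with nonnegative integer coefficients. -}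

module Defs where

open import Data.Nat using (ℕ; zero; suc; _∸_)
open import Data.Integer as ℤ using (ℤ; 0ℤ; 1ℤ)

-- The polynomial ring ℤ[s,t], represented by coefficient functions:
-- p i j is the coefficient of s^i t^j.  All polynomials built below
-- have finite support.  Equality is coefficientwise.
Poly : Set
Poly = ℕ → ℕ → ℤ

_≐_ : Poly → Poly → Set
p ≐ q = ∀ i j → p i j ≡ q i j
  where open import Relation.Binary.PropositionalEquality using (_≡_)

infixl 6 _⊕_
infixl 7 _⊗_
infix 4 _≐_

0P : Poly
0P _ _ = 0ℤ

1P : Poly
1P zero zero = 1ℤ
1P _    _    = 0ℤ

sP : Poly
sP (suc zero) zero = 1ℤ
sP _          _    = 0ℤ

tP : Poly
tP zero (suc zero) = 1ℤ
tP _    _          = 0ℤ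

_⊕_ : Poly → Poly → Poly
(p ⊕ q) i j = p i j ℤ.+ q i j

sumTo : ℕ → (ℕ → ℤ) → ℤ
sumTo zero    f = f zero
sumTo (suc n) f = sumTo n f ℤ.+ f (suc n)

_⊗_ : Poly → Poly → Poly
(p ⊗ q) i j = sumTo i (λ a → sumTo j (λ b → p a b ℤ.* q (i ∸ a) (j ∸ b)))

lucas : ℕ → Poly
lucas zero          = 0P
lucas (suc zero)    = 1P
lucas (suc (suc n)) = sP ⊗ lucas (suc n) ⊕ tP ⊗ lucas n

-- Lucas-Eulerian numbers E_{n,k} for n,k ≥ 0 (E_{n,k} = 0 for k < 0
-- is built in by omitting negative k; E_{n,k} = 0 for n < k).
-- E_{0,0} = 1, E_{n,0} = 1, and for 1 ≤ k:
-- E_{n,k} = {k+1} E_{n-1,k} + {n-k+1} E_{n-1,k-1}.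
-- (For k = n this gives {n+1}·0 + {1}·E_{n-1,n-1} = 1, and for k > n
-- it gives 0, consistent with the stated initial conditions.)
E : ℕ → ℕ → Poly
E zero    zero    = 1P
E zero    (suc k) = 0P
E (suc n) zero    = 1P
E (suc n) (suc k) =
  lucas (suc (suc k)) ⊗ E n (suc k) ⊕ lucas (suc (suc n ∸ suc k)) ⊗ E n k

-- Writing n = k + m removes the truncated subtraction: the claim becomes
-- E_{k+m,k} = E_{k+m,m}.  The recursion for E_{k+m,k} has coefficients
-- {k+1} and {m+1}, and the recursion for E_{k+m,m} has the same two
-- coefficients in the other order, so after applying the induction
-- hypothesis to both lower terms the two right-hand sides differ only by
-- the order of the summands.
module Submission where

open import Defs
open import Data.Nat using (ℕ; zero; suc; _+_; _∸_; _≤_; _<_; s≤s)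
open import Data.Nat.Properties
  using (+-identityʳ; +-suc; m+n∸m≡n; m+n∸n≡m; m+[n∸m]≡n; n∸n≡0; m≤n⇒m≤1+n; n<1+n)
open import Data.Integer using (0ℤ) renaming (_+_ to _+ℤ_; _*_ to _*ℤ_)
import Data.Integer.Properties as ℤ
open import Relation.Binary.Bundles using (Setoid)
open import Relation.Binary.PropositionalEquality
  using (_≡_; refl; sym; trans; cong; cong₂; subst; module ≡-Reasoning)

≐-setoid : Setoid _ _
≐-setoid = record
  { Carrier       = Poly
  ; _≈_           = _≐_
  ; isEquivalence = record
    { refl  = λ _ _ → refl
    ; sym   = λ p≐q i j → sym (p≐q i j)
    ; trans = λ p≐q q≐r i j → trans (p≐q i j) (q≐r i j)
    }
  }

open Setoid ≐-setoid using () renaming (refl to ≐-refl; sym to ≐-sym; trans to ≐-trans)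
import Relation.Binary.Reasoning.Setoid ≐-setoid as ≐-Reasoning

sumTo-cong : ∀ n {f g} → (∀ a → f a ≡ g a) → sumTo n f ≡ sumTo n g
sumTo-cong zero    f≡g = f≡g zero
sumTo-cong (suc n) f≡g = cong₂ _+ℤ_ (sumTo-cong n f≡g) (f≡g (suc n))

sumTo-zero : ∀ n {f} → (∀ a → f a ≡ 0ℤ) → sumTo n f ≡ 0ℤ
sumTo-zero zero    f≡0 = f≡0 zero
sumTo-zero (suc n) f≡0 = cong₂ _+ℤ_ (sumTo-zero n f≡0) (f≡0 (suc n))

sumTo-head : ∀ n {f} → (∀ a → f (suc a) ≡ 0ℤ) → sumTo n f ≡ f zero
sumTo-head zero        tail≡0 = refl
sumTo-head (suc n) {f} tail≡0 =
  trans (cong₂ _+ℤ_ (sumTo-head n tail≡0) (tail≡0 n)) (ℤ.+-identityʳ (f zero))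

⊕-cong : ∀ {p p′ q q′} → p ≐ p′ → q ≐ q′ → p ⊕ q ≐ p′ ⊕ q′
⊕-cong p≐p′ q≐q′ i j = cong₂ _+ℤ_ (p≐p′ i j) (q≐q′ i j)

⊕-comm : ∀ p q → p ⊕ q ≐ q ⊕ p
⊕-comm p q i j = ℤ.+-comm (p i j) (q i j)

⊕-identityˡ : ∀ p → 0P ⊕ p ≐ p
⊕-identityˡ p i j = ℤ.+-identityˡ (p i j)

⊗-cong : ∀ {p p′ q q′} → p ≐ p′ → q ≐ q′ → p ⊗ q ≐ p′ ⊗ q′
⊗-cong p≐p′ q≐q′ i j =
  sumTo-cong i λ a → sumTo-cong j λ b →
    cong₂ _*ℤ_ (p≐p′ a b) (q≐q′ (i ∸ a) (j ∸ b))

-- _⊕_ and _⊗_ are defined pointwise, so their operands cannot be inferred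
-- by unification; the one-sided congruences take the fixed operand explicitly.
⊗-congʳ : ∀ p {q q′} → q ≐ q′ → p ⊗ q ≐ p ⊗ q′
⊗-congʳ p = ⊗-cong {p} ≐-refl

⊗-congˡ : ∀ {p p′} q → p ≐ p′ → p ⊗ q ≐ p′ ⊗ q
⊗-congˡ q p≐p′ = ⊗-cong {q = q} p≐p′ ≐-refl

⊗-zeroʳ : ∀ p → p ⊗ 0P ≐ 0P
⊗-zeroʳ p i j = sumTo-zero i λ a → sumTo-zero j λ b → ℤ.*-zeroʳ (p a b)

⊗-annihilatedʳ : ∀ p {q} → q ≐ 0P → p ⊗ q ≐ 0P
⊗-annihilatedʳ p q≐0 = ≐-trans (⊗-congʳ p q≐0) (⊗-zeroʳ p)

⊗-identityˡ : ∀ q → 1P ⊗ q ≐ q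
⊗-identityˡ q i j = begin
  sumTo i (λ a → sumTo j (λ b → 1P a b *ℤ q (i ∸ a) (j ∸ b)))
    ≡⟨ sumTo-head i (λ a → sumTo-zero j λ b → ℤ.*-zeroˡ (q (i ∸ suc a) (j ∸ b))) ⟩
  sumTo j (λ b → 1P zero b *ℤ q i (j ∸ b))
    ≡⟨ sumTo-head j (λ b → ℤ.*-zeroˡ (q i (j ∸ suc b))) ⟩
  1P zero zero *ℤ q i j
    ≡⟨ ℤ.*-identityˡ (q i j) ⟩
  q i j ∎
  where open ≡-Reasoning

lucas-≡ : ∀ {a b} → a ≡ b → lucas a ≐ lucas b
lucas-≡ refl = ≐-refl

E-≡ : ∀ {n n′} k → n ≡ n′ → E n k ≐ E n′ k
E-≡ k refl = ≐-refl

E-above-diagonal : ∀ {n k} → n < k → E n k ≐ 0P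
E-above-diagonal {zero}  {suc k} _        = ≐-refl
E-above-diagonal {suc n} {suc k} (s≤s n<k) =
  ⊕-cong (⊗-annihilatedʳ (lucas (suc (suc k))) (E-above-diagonal (m≤n⇒m≤1+n n<k)))
         (⊗-annihilatedʳ (lucas (suc (n ∸ k))) (E-above-diagonal n<k))

E-diagonal : ∀ n → E n n ≐ 1P
E-diagonal zero    = ≐-refl
E-diagonal (suc n) = begin
  lucas (suc (suc n)) ⊗ E n (suc n) ⊕ lucas (suc (n ∸ n)) ⊗ E n n
    ≈⟨ ⊕-cong (⊗-annihilatedʳ (lucas (suc (suc n))) (E-above-diagonal (n<1+n n)))
              (⊗-cong (lucas-≡ (cong suc (n∸n≡0 n))) (E-diagonal n)) ⟩
  0P ⊕ 1P ⊗ 1P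
    ≈⟨ ⊕-cong (≐-refl {0P}) (⊗-identityˡ 1P) ⟩
  0P ⊕ 1P
    ≈⟨ ⊕-identityˡ 1P ⟩
  1P ∎
  where open ≐-Reasoning

E-palindromic : ∀ k m → E (k + m) k ≐ E (k + m) m
E-palindromic zero    m       = ≐-trans (E-zeroʳ m) (≐-sym (E-diagonal m))
  where
  E-zeroʳ : ∀ n → E n 0 ≐ 1P
  E-zeroʳ zero    = ≐-refl
  E-zeroʳ (suc n) = ≐-refl
E-palindromic (suc k) zero    = ≐-trans (E-≡ (suc k) (+-identityʳ (suc k))) (E-diagonal (suc k))
E-palindromic (suc k) (suc m) = begin
  lucas (suc (suc k)) ⊗ E n (suc k) ⊕ lucas (suc (n ∸ k)) ⊗ E n k
    ≈⟨ ⊕-cong (⊗-congʳ (lucas (suc (suc k))) lower-k)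
              (⊗-cong (lucas-≡ (cong suc (m+n∸m≡n k (suc m)))) (E-palindromic k (suc m))) ⟩
  lucas (suc (suc k)) ⊗ E n m ⊕ lucas (suc (suc m)) ⊗ E n (suc m)
    ≈⟨ ⊕-comm (lucas (suc (suc k)) ⊗ E n m) (lucas (suc (suc m)) ⊗ E n (suc m)) ⟩
  lucas (suc (suc m)) ⊗ E n (suc m) ⊕ lucas (suc (suc k)) ⊗ E n m
    ≈⟨ ⊕-cong (≐-refl {lucas (suc (suc m)) ⊗ E n (suc m)})
              (⊗-congˡ (E n m) (lucas-≡ (cong suc (sym n∸m≡1+k)))) ⟩
  lucas (suc (suc m)) ⊗ E n (suc m) ⊕ lucas (suc (n ∸ m)) ⊗ E n m ∎
  where
  open ≐-Reasoning
  n = k + suc m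
  lower-k : E n (suc k) ≐ E n m
  lower-k = ≐-trans (E-≡ (suc k) (+-suc k m))
                    (≐-trans (E-palindromic (suc k) m) (E-≡ m (sym (+-suc k m))))
  n∸m≡1+k : n ∸ m ≡ suc k
  n∸m≡1+k = trans (cong (_∸ m) (+-suc k m)) (m+n∸n≡m (suc k) m)

theorem2 : (n k : ℕ) → k ≤ n → E n k ≐ E n (n ∸ k)
theorem2 n k k≤n =
  subst (λ x → E x k ≐ E x (n ∸ k)) (m+[n∸m]≡n k≤n) (E-palindromic k (n ∸ k))
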